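{- For all $n \geq 1$, the number $D_n$ of DOAGs with $n$ vertices satisfies $D_n \leq \mathrm{sf}(n-1)\, e^{n-1}$, where $\mathrm{sf}(k) = \prod_{i=0}^{k} i!$.
   Context: A directed ordered acyclic graph (DOAG) is a tuple $(V, E, (\prec_v)_{v \in V \cup \{\emptyset\}})$ where $V$ is a finite set of vertices, $E \subseteq V \times V$ is a set of edges such that $(V,E)$ is acyclic, for each $v \in V$, $\prec_v$ is a total order on the outgoing edges of $v$, and $\prec_\emptyset$ is a total order on the sources (vertices with no incoming edge). Two DOAGs are equal if there is a bijection of vertex sets preserving edges and all orders. $D_n$ is the number of DOAGs with $n$ vertices and any number of edges and sources. -}

module Defs where

open import Data.Nat using (ℕ; zero; suc; _^_; _!; _*_)
open import Data.Nat.Properties using (_!≢0)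
open import Data.Fin using (Fin)
open import Data.List using (List; map)
open import Data.List.Membership.Propositional using (_∈_; _∉_)
open import Data.List.Relation.Unary.Unique.Propositional using (Unique)
open import Data.Product using (Σ; _×_)
open import Data.Integer using (+_)
open import Data.Rational using (ℚ; _/_) renaming (_+_ to _+ℚ_)
open import Function.Bundles using (_⇔_; _⤖_; Bijection)
open import Relation.Binary.PropositionalEquality using (_≡_)
open import Relation.Binary.Construct.Closure.Transitive using (TransClosure)
open import Relation.Nullary using (¬_)

-- A DOAG on the vertex set Fin n.
--  * out v     : the outgoing edges of v, listed in the order ≺_v
--                (edge (v,w) is present iff w ∈ out v; no repeated edges)
--  * sources   : the sources, listed in the order ≺_∅
record DOAG (n : ℕ) : Set where
  field
    out        : Fin n → List (Fin n)
    outUnique  : ∀ v → Unique (out v)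
    sources    : List (Fin n)
    srcUnique  : Unique sources
    srcSpec    : ∀ v → (v ∈ sources) ⇔ (∀ u → v ∉ out u)
    acyclic    : ∀ v → ¬ TransClosure (λ u w → w ∈ out u) v v

open DOAG public

_≅_ : ∀ {n} → DOAG n → DOAG n → Set
_≅_ {n} G H = Σ (Fin n ⤖ Fin n) λ σ →
  (∀ v → map (Bijection.to σ) (out G v) ≡ out H (Bijection.to σ v))
  × (map (Bijection.to σ) (sources G) ≡ sources H)

sf : ℕ → ℕ
sf zero    = 1
sf (suc k) = sf k * (suc k) !

-- partial sums of the exponential series: expPartial x K = Σ_{k=0}^{K} x^k / k!
-- (these increase to e^x; used to express the real number e^x)
expPartial : ℕ → ℕ → ℚ
expPartial x zero    = (+ 1) / 1
expPartial x (suc K) =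
  expPartial x K +ℚ ((+ (x ^ suc K)) / (suc K !)) {{(suc K) !≢0}}

-- Order the vertices of a DOAG so that every vertex comes after its children and the sources come last,
-- in their order ≺_∅; non-sources are added greedily, and acyclicity guarantees that all of them get added.
-- Recording, for the i-th vertex, the positions of its children listed in the order ≺_v gives an injective
-- list of numbers below i, and DOAGs with equal records are isomorphic. Hence D_n ≤ ∏_{i<n} A(i), where
-- A(i) = Σ_{j≤i} i!/j! = i!·E_i(1) counts the injective lists below i and E_K(x) = Σ_{j≤K} x^j/j!.
-- Finally ∏_{i≤m} E_i(1) ≤ E_m(K) for some K, since by the binomial theorem the Cauchy product of the
-- partial sums gives E_a(x)·E_b(1) ≤ E_{a+b}(x+1).

module Submission where

open import Algebra.Bundles using (CommutativeSemiring)
open import Level using (0ℓ)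

module PartialSums (S : CommutativeSemiring 0ℓ 0ℓ) where

  open import Data.Nat using (ℕ; zero; suc; _≤_; z≤n; s≤s)
  open import Function using (_∘_)
  open CommutativeSemiring S
    using (Carrier; _≈_; _+_; _*_; setoid; +-cong; +-congˡ; +-assoc; distribˡ; +-commutativeSemigroup)
    renaming (refl to ≈-refl; sym to ≈-sym; trans to ≈-trans)
  open import Algebra.Properties.CommutativeSemigroup +-commutativeSemigroup using (interchange)
  open import Relation.Binary.Reasoning.Setoid setoid

  ∑≤ : (ℕ → Carrier) → ℕ → Carrier
  ∑≤ f zero    = f 0
  ∑≤ f (suc k) = f 0 + ∑≤ (f ∘ suc) k

  ∑≤-cong : ∀ {f g} k → (∀ i → i ≤ k → f i ≈ g i) → ∑≤ f k ≈ ∑≤ g k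
  ∑≤-cong zero    f≈g = f≈g 0 z≤n
  ∑≤-cong (suc k) f≈g = +-cong (f≈g 0 z≤n) (∑≤-cong k (λ i i≤k → f≈g (suc i) (s≤s i≤k)))

  ∑≤-+ : ∀ f g k → ∑≤ (λ i → f i + g i) k ≈ ∑≤ f k + ∑≤ g k
  ∑≤-+ f g zero    = ≈-refl
  ∑≤-+ f g (suc k) = begin
    (f 0 + g 0) + ∑≤ (λ i → f (suc i) + g (suc i)) k ≈⟨ +-congˡ (∑≤-+ (f ∘ suc) (g ∘ suc) k) ⟩
    (f 0 + g 0) + (∑≤ (f ∘ suc) k + ∑≤ (g ∘ suc) k) ≈⟨ interchange (f 0) (g 0) _ _ ⟩
    ∑≤ f (suc k) + ∑≤ g (suc k)                      ∎

  ∑≤-*ˡ : ∀ c f k → ∑≤ (λ i → c * f i) k ≈ c * ∑≤ f k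
  ∑≤-*ˡ c f zero    = ≈-refl
  ∑≤-*ˡ c f (suc k) = ≈-trans (+-congˡ (∑≤-*ˡ c (f ∘ suc) k)) (≈-sym (distribˡ c (f 0) _))

  ∑≤-suc : ∀ f k → ∑≤ f (suc k) ≈ ∑≤ f k + f (suc k)
  ∑≤-suc f zero    = ≈-refl
  ∑≤-suc f (suc k) = ≈-trans (+-congˡ (∑≤-suc (f ∘ suc) k)) (≈-sym (+-assoc (f 0) _ _))

module Counting where

  open import Defs
  open import Data.Empty using (⊥-elim)
  open import Data.Fin as Fin using (Fin; toℕ)
  open import Data.Fin.Properties using (any?; pigeonhole)
  open import Data.List using (List; []; _∷_; _++_; length; map; filter; upTo; cartesianProductWith)
  import Data.List.Membership.DecPropositional as DecMembership
  open import Data.List.Membership.Propositional using (_∈_; _∉_; _─_; find)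
  open import Data.List.Membership.Propositional.Properties
    using (∈-++⁺ˡ; ∈-++⁺ʳ; ∈-map⁺; ∈-map⁻; ∈-allFin; ∈-upTo⁺; ∈-cartesianProductWith⁺)
  open import Data.List.Properties
    using (∷-injective; length-++; length-map; length-removeAt′; length-tabulate; length-upTo;
           ++-assoc; map-∘; map-cong; map-id; map-id-local; filter-++; filter-none; filter-all)
  open import Data.List.Relation.Binary.Subset.Propositional using (_⊆_)
  open import Data.List.Relation.Unary.All as All using (All; []; _∷_)
  open import Data.List.Relation.Unary.All.Properties using (++⁺; ¬All⇒Any¬) renaming (map⁺ to All-map⁺)
  open import Data.List.Relation.Unary.AllPairs as AllPairs using (AllPairs; []; _∷_)
  import Data.List.Relation.Unary.AllPairs.Properties as AllPairs
  open import Data.List.Relation.Unary.Any using (here; there; index)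
  open import Data.List.Relation.Unary.Unique.Propositional using (Unique)
  open import Data.List.Relation.Unary.Unique.Propositional.Properties as Unique using ()
  open import Data.Nat as ℕ using (ℕ; zero; suc; _+_; _*_; _∸_; _≤_; _<_; z≤n; s≤s; s≤s⁻¹)
  open import Data.Nat.Properties
    using (≤-refl; ≤-antisym; ≤-reflexive; ≤-trans; ≤⇒≯; ≤∧≢⇒<; n<1+n; suc-injective;
           +-suc; +-comm; +-identityʳ; m∸n+n≡m; module ≤-Reasoning)
  open import Data.Product using (Σ; ∃-syntax; _×_; _,_; proj₁; proj₂)
  open import Data.Sum using (_⊎_; inj₁; inj₂)
  open import Data.Unit using (⊤; tt)
  open import Function using (_∘_)
  open import Function.Bundles using (Equivalence; mk⤖)
  open import Relation.Binary.Construct.Closure.Transitive using (TransClosure; [_]; _∷ʳ_)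
  open import Relation.Binary.Definitions using (DecidableEquality)
  open import Relation.Binary.PropositionalEquality
    using (_≡_; _≢_; refl; sym; trans; cong; cong₂; subst; module ≡-Reasoning)
  open import Relation.Nullary using (¬_; Dec; yes; no)
  open import Relation.Nullary.Decidable using (¬?; _×-dec_)

  ∈-─ : ∀ {A : Set} {x z : A} {ys} (x∈ys : x ∈ ys) → z ∈ ys → x ≢ z → z ∈ ys ─ x∈ys
  ∈-─ (here refl) (here refl) x≢z = ⊥-elim (x≢z refl)
  ∈-─ (here _)    (there z∈)  _   = z∈
  ∈-─ (there _)   (here refl) _   = here refl
  ∈-─ (there x∈)  (there z∈)  x≢z = there (∈-─ x∈ z∈ x≢z)

  unique-⊆⇒length-≤ : ∀ {A : Set} {xs ys : List A} → Unique xs → xs ⊆ ys → length xs ≤ length ys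
  unique-⊆⇒length-≤ {xs = []} _ _ = z≤n
  unique-⊆⇒length-≤ {xs = x ∷ xs} {ys} (x∉xs ∷ u) xs⊆ys =
    ≤-trans (s≤s (unique-⊆⇒length-≤ u xs⊆ys─x)) (≤-reflexive (sym (length-removeAt′ ys (index x∈ys))))
    where
      x∈ys : x ∈ ys
      x∈ys = xs⊆ys (here refl)

      xs⊆ys─x : xs ⊆ ys ─ x∈ys
      xs⊆ys─x z∈xs = ∈-─ x∈ys (xs⊆ys (there z∈xs)) (All.lookup x∉xs z∈xs)

  unique⇒length-≤ : ∀ {n} {xs : List (Fin n)} → Unique xs → length xs ≤ n
  unique⇒length-≤ {n} {xs} u = subst (length xs ≤_) (length-tabulate (λ i → i)) (unique-⊆⇒length-≤ u (λ {x} _ → ∈-allFin x))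

  length-snoc : ∀ {A : Set} (xs : List A) x → length (xs ++ x ∷ []) ≡ suc (length xs)
  length-snoc xs x = trans (length-++ xs) (+-comm (length xs) 1)

  ++-split : ∀ {A : Set} (xs ys pre : List A) v suf → xs ++ ys ≡ pre ++ v ∷ suf →
             (∃[ suf′ ] xs ≡ pre ++ v ∷ suf′) ⊎ (∃[ mid ] pre ≡ xs ++ mid × ys ≡ mid ++ v ∷ suf)
  ++-split []       ys pre       v suf eq = inj₂ (pre , refl , eq)
  ++-split (x ∷ xs) ys []        v suf refl = inj₁ (xs , refl)
  ++-split (x ∷ xs) ys (p ∷ pre) v suf eq with refl , eq′ ← ∷-injective eq with ++-split xs ys pre v suf eq′
  ... | inj₁ (suf′ , refl)    = inj₁ (suf′ , refl)
  ... | inj₂ (mid , refl , e) = inj₂ (mid , refl , e)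

  module _ {A : Set} where

    nth : A → List A → ℕ → A
    nth d []       k       = d
    nth d (x ∷ xs) zero    = x
    nth d (x ∷ xs) (suc k) = nth d xs k

    nth-∈ : ∀ d xs k → k < length xs → nth d xs k ∈ xs
    nth-∈ d (x ∷ xs) zero    _         = here refl
    nth-∈ d (x ∷ xs) (suc k) (s≤s k<) = there (nth-∈ d xs k k<)

    nth-extensionality : ∀ d (xs ys : List A) → length xs ≡ length ys →
                         (∀ k → k < length xs → nth d xs k ≡ nth d ys k) → xs ≡ ys
    nth-extensionality d []       []       _   _  = refl
    nth-extensionality d (x ∷ xs) (y ∷ ys) len eq =
      cong₂ _∷_ (eq zero (s≤s z≤n)) (nth-extensionality d xs ys (suc-injective len) (λ k k< → eq (suc k) (s≤s k<)))

  nth-map : ∀ {A B : Set} (f : A → B) d d′ xs k → k < length xs → nth d′ (map f xs) k ≡ f (nth d xs k)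
  nth-map f d d′ (x ∷ xs) zero    _         = refl
  nth-map f d d′ (x ∷ xs) (suc k) (s≤s k<) = nth-map f d d′ xs k k<

  module Position {A : Set} (_≟_ : DecidableEquality A) where

    position : List A → A → ℕ
    position []       v = zero
    position (x ∷ xs) v with x ≟ v
    ... | yes _ = zero
    ... | no  _ = suc (position xs v)

    nth-position : ∀ d {xs v} → v ∈ xs → nth d xs (position xs v) ≡ v
    nth-position d {x ∷ xs} {v} v∈ with x ≟ v
    nth-position d {x ∷ xs}     _          | yes x≡v = x≡v
    nth-position d {x ∷ xs}     (here v≡x) | no  x≢v = ⊥-elim (x≢v (sym v≡x))
    nth-position d {x ∷ xs}     (there v∈) | no  _   = nth-position d v∈

    position<length : ∀ {xs v} → v ∈ xs → position xs v < length xs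
    position<length {x ∷ xs} {v} v∈ with x ≟ v
    position<length {x ∷ xs}     _          | yes _   = s≤s z≤n
    position<length {x ∷ xs}     (here v≡x) | no  x≢v = ⊥-elim (x≢v (sym v≡x))
    position<length {x ∷ xs}     (there v∈) | no  _   = s≤s (position<length v∈)

    position-nth : ∀ d {xs} → Unique xs → ∀ k → k < length xs → position xs (nth d xs k) ≡ k
    position-nth d {x ∷ xs} _ zero _ with x ≟ x
    ... | yes _   = refl
    ... | no  x≢x = ⊥-elim (x≢x refl)
    position-nth d {x ∷ xs} (x∉xs ∷ u) (suc k) (s≤s k<) with x ≟ nth d xs k
    ... | yes x≡ = ⊥-elim (All.lookup x∉xs (nth-∈ d xs k k<) x≡)
    ... | no  _  = cong suc (position-nth d u k k<)

    position-++ˡ : ∀ {xs ys v} → v ∈ xs → position (xs ++ ys) v ≡ position xs v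
    position-++ˡ {x ∷ xs} {ys} {v} v∈ with x ≟ v
    position-++ˡ {x ∷ xs}          _          | yes _   = refl
    position-++ˡ {x ∷ xs}          (here v≡x) | no  x≢v = ⊥-elim (x≢v (sym v≡x))
    position-++ˡ {x ∷ xs}          (there v∈) | no  _   = cong suc (position-++ˡ v∈)

    position-injective : ∀ {xs u w} → u ∈ xs → w ∈ xs → position xs u ≡ position xs w → u ≡ w
    position-injective {xs} {u} {w} u∈ w∈ eq =
      trans (sym (nth-position u u∈)) (trans (cong (nth u xs) eq) (nth-position u w∈))

  map-filter : ∀ {A B : Set} {P : A → Set} {Q : B → Set} (P? : ∀ x → Dec (P x)) (Q? : ∀ y → Dec (Q y)) (f : A → B) →
               (∀ x → P x → Q (f x)) → (∀ x → Q (f x) → P x) → ∀ xs → map f (filter P? xs) ≡ filter Q? (map f xs)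
  map-filter P? Q? f P⇒Q Q⇒P []       = refl
  map-filter P? Q? f P⇒Q Q⇒P (x ∷ xs) with P? x | Q? (f x)
  ... | yes _  | yes _  = cong (f x ∷_) (map-filter P? Q? f P⇒Q Q⇒P xs)
  ... | yes Px | no ¬Q  = ⊥-elim (¬Q (P⇒Q x Px))
  ... | no ¬P  | yes Qx = ⊥-elim (¬P (Q⇒P x Qx))
  ... | no _   | no _   = map-filter P? Q? f P⇒Q Q⇒P xs

  length-cartesianProductWith : ∀ {A B C : Set} (f : A → B → C) xs ys →
                                length (cartesianProductWith f xs ys) ≡ length xs * length ys
  length-cartesianProductWith f []       ys = refl
  length-cartesianProductWith f (x ∷ xs) ys =
    trans (length-++ (map (f x) ys)) (cong₂ _+_ (length-map (f x) ys) (length-cartesianProductWith f xs ys))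

  module _ {n : ℕ} (E : Fin n → Fin n → Set) (E-acyclic : ∀ v → ¬ TransClosure E v v) where

    -- A walk can be continued forever inside R, so by pigeonhole it revisits a vertex and closes a cycle.
    ¬successor-closed : (R : Fin n → Set) → (∀ w → R w → ∃[ w′ ] E w w′ × R w′) → ∀ v → ¬ R v
    ¬successor-closed R step v Rv = E-acyclic _ (proj₂ cycle)
      where
        at : ℕ → Σ (Fin n) R
        at zero    = v , Rv
        at (suc k) = let w , _ , Rw = step _ (proj₂ (at k)) in w , Rw

        vertex : ℕ → Fin n
        vertex k = proj₁ (at k)

        edge : ∀ k → E (vertex k) (vertex (suc k))
        edge k = proj₁ (proj₂ (step _ (proj₂ (at k))))

        path : ∀ k d → TransClosure E (vertex k) (vertex (d + suc k))
        path k zero    = [ edge k ]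
        path k (suc d) = path k d ∷ʳ edge (d + suc k)

        path< : ∀ {i j} → i < j → TransClosure E (vertex i) (vertex j)
        path< {i} {j} i<j = subst (TransClosure E (vertex i) ∘ vertex) (m∸n+n≡m i<j) (path i (j ∸ suc i))

        cycle : ∃[ k ] TransClosure E (vertex k) (vertex k)
        cycle with i , j , i<j , vi≡vj ← pigeonhole (n<1+n n) (vertex ∘ toℕ) =
          toℕ i , subst (TransClosure E (vertex (toℕ i))) (sym vi≡vj) (path< i<j)

  _∈?_ : ∀ {n} (v : Fin n) vs → Dec (v ∈ vs)
  _∈?_ = DecMembership._∈?_ Fin._≟_

  ChildrenFirst : ∀ {n} → DOAG n → List (Fin n) → Set
  ChildrenFirst G vs = ∀ pre v suf → vs ≡ pre ++ v ∷ suf → All (_∈ pre) (out G v)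

  child∉sources : ∀ {n} (G : DOAG n) {u w} → w ∈ out G u → w ∉ sources G
  child∉sources G {u} {w} w∈out w∈sources = Equivalence.to (srcSpec G w) w∈sources u w∈out

  record SourcesLastOrder {n : ℕ} (G : DOAG n) : Set where
    field
      inner            : List (Fin n)
      inner-nonSources : All (_∉ sources G) inner
      unique           : Unique (inner ++ sources G)
      complete         : ∀ v → v ∈ inner ++ sources G
      childrenFirst    : ChildrenFirst G (inner ++ sources G)

    order : List (Fin n)
    order = inner ++ sources G

  module _ {n : ℕ} (G : DOAG n) where

    Ready : List (Fin n) → Fin n → Set
    Ready vs v = v ∉ vs × v ∉ sources G × All (_∈ vs) (out G v)

    ready? : ∀ vs v → Dec (Ready vs v)
    ready? vs v = ¬? (v ∈? vs) ×-dec ¬? (v ∈? sources G) ×-dec All.all? (_∈? vs) (out G v)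

    Saturated : List (Fin n) → Set
    Saturated vs = ∀ v → ¬ Ready vs v

    record InnerPrefix (vs : List (Fin n)) : Set where
      field
        unique        : Unique vs
        nonSources    : All (_∉ sources G) vs
        childrenFirst : ChildrenFirst G vs
    open InnerPrefix

    []-innerPrefix : InnerPrefix []
    []-innerPrefix = record { unique = [] ; nonSources = [] ; childrenFirst = λ { [] _ _ () ; (_ ∷ _) _ _ () } }

    snoc-innerPrefix : ∀ {vs v} → InnerPrefix vs → Ready vs v → InnerPrefix (vs ++ v ∷ [])
    snoc-innerPrefix {vs} {v} P (v∉vs , v∉sources , children∈vs) = record
      { unique        = Unique.++⁺ (unique P) ([] ∷ []) (λ { (v∈vs , here refl) → v∉vs v∈vs })
      ; nonSources    = ++⁺ (nonSources P) (v∉sources ∷ [])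
      ; childrenFirst = childrenFirst′
      }
      where
        childrenFirst′ : ChildrenFirst G (vs ++ v ∷ [])
        childrenFirst′ pre w suf eq with ++-split vs (v ∷ []) pre w suf eq
        ... | inj₁ (suf′ , vs≡)             = childrenFirst P pre w suf′ vs≡
        ... | inj₂ ([] , refl , refl)       = All.map ∈-++⁺ˡ children∈vs
        ... | inj₂ (_ ∷ [] , _ , ())
        ... | inj₂ (_ ∷ _ ∷ _ , _ , ())

    grow : ∀ fuel {vs} → InnerPrefix vs →
           Σ (List (Fin n)) λ ws → InnerPrefix ws × (Saturated ws ⊎ fuel + length vs ≤ length ws)
    grow zero    {vs} P = vs , P , inj₂ ≤-refl
    grow (suc fuel) {vs} P with any? (ready? vs)
    ... | no ¬ready = vs , P , inj₁ (λ v r → ¬ready (v , r))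
    ... | yes (v , r) with grow fuel (snoc-innerPrefix P r)
    ...   | ws , P′ , inj₁ sat = ws , P′ , inj₁ sat
    ...   | ws , P′ , inj₂ le  =
      ws , P′ , inj₂ (subst (_≤ length ws) (trans (cong (fuel +_) (length-snoc vs v)) (+-suc fuel (length vs))) le)

    -- n + 1 steps of growth are impossible, as a duplicate-free list of vertices has length at most n.
    saturatedPrefix : Σ (List (Fin n)) λ vs → InnerPrefix vs × Saturated vs
    saturatedPrefix with grow (suc n) []-innerPrefix
    ... | vs , P , inj₁ sat = vs , P , sat
    ... | vs , P , inj₂ le  = ⊥-elim (≤⇒≯ (unique⇒length-≤ (unique P)) (subst (_≤ length vs) (+-identityʳ (suc n)) le))

    -- A non-source outside a saturated prefix has a child outside it, which is again a non-source.
    saturated-nonSource∈ : ∀ v → v ∉ sources G → v ∈ proj₁ saturatedPrefix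
    saturated-nonSource∈ v v∉sources with v ∈? proj₁ saturatedPrefix
    ... | yes v∈ = v∈
    ... | no v∉  = ⊥-elim (¬successor-closed (λ u w → w ∈ out G u) (acyclic G) Outside step v (v∉ , v∉sources))
      where
        vs : List (Fin n)
        vs = proj₁ saturatedPrefix

        saturated : Saturated vs
        saturated = proj₂ (proj₂ saturatedPrefix)

        Outside : Fin n → Set
        Outside w = w ∉ vs × w ∉ sources G

        step : ∀ w → Outside w → ∃[ w′ ] w′ ∈ out G w × Outside w′
        step w (w∉ , w∉sources)
          with w′ , w′∈out , w′∉ ← find (¬All⇒Any¬ (_∈? vs) (out G w) (λ children∈ → saturated w (w∉ , w∉sources , children∈)))
          = w′ , w′∈out , w′∉ , child∉sources G w′∈out

  sourcesLastOrder : ∀ {n} (G : DOAG n) → SourcesLastOrder G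
  sourcesLastOrder {n} G = record
    { inner            = vs
    ; inner-nonSources = InnerPrefix.nonSources P
    ; unique           = Unique.++⁺ (InnerPrefix.unique P) (srcUnique G) λ { (v∈vs , v∈sources) →
                           All.lookup (InnerPrefix.nonSources P) v∈vs v∈sources }
    ; complete         = complete
    ; childrenFirst    = childrenFirst
    }
    where
      vs : List (Fin n)
      vs = proj₁ (saturatedPrefix G)

      P : InnerPrefix G vs
      P = proj₁ (proj₂ (saturatedPrefix G))

      complete : ∀ v → v ∈ vs ++ sources G
      complete v with v ∈? sources G
      ... | yes v∈sources = ∈-++⁺ʳ vs v∈sources
      ... | no v∉sources  = ∈-++⁺ˡ (saturated-nonSource∈ G v v∉sources)

      childrenFirst : ChildrenFirst G (vs ++ sources G)
      childrenFirst pre v suf eq with ++-split vs (sources G) pre v suf eq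
      ... | inj₁ (suf′ , vs≡)        = InnerPrefix.childrenFirst P pre v suf′ vs≡
      ... | inj₂ (mid , refl , _) = All.tabulate λ w∈out → ∈-++⁺ˡ (saturated-nonSource∈ G _ (child∉sources G w∈out))

  transpose : ℕ → ℕ → ℕ → ℕ
  transpose x k y with y ℕ.≟ x | y ℕ.≟ k
  ... | yes _ | _     = k
  ... | no  _ | yes _ = x
  ... | no  _ | no  _ = y

  transpose-left : ∀ x k → transpose x k x ≡ k
  transpose-left x k with x ℕ.≟ x
  ... | yes _   = refl
  ... | no  x≢x = ⊥-elim (x≢x refl)

  transpose-right : ∀ x k → transpose x k k ≡ x
  transpose-right x k with k ℕ.≟ x | k ℕ.≟ k
  ... | yes k≡x | _       = k≡x
  ... | no  _   | yes _   = refl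
  ... | no  _   | no  k≢k = ⊥-elim (k≢k refl)

  transpose-involutive : ∀ x k y → transpose x k (transpose x k y) ≡ y
  transpose-involutive x k y with y ℕ.≟ x | y ℕ.≟ k
  ... | yes refl | _        = transpose-right y k
  ... | no  _    | yes refl = transpose-left x y
  ... | no  y≢x  | no  y≢k  with y ℕ.≟ x | y ℕ.≟ k
  ...   | yes y≡x | _       = ⊥-elim (y≢x y≡x)
  ...   | no  _   | yes y≡k = ⊥-elim (y≢k y≡k)
  ...   | no  _   | no  _   = refl

  transpose-injective : ∀ x k {y z} → transpose x k y ≡ transpose x k z → y ≡ z
  transpose-injective x k {y} {z} eq =
    trans (sym (transpose-involutive x k y)) (trans (cong (transpose x k) eq) (transpose-involutive x k z))

  transpose-< : ∀ {x k y} → x < suc k → y < suc k → y ≢ x → transpose x k y < k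
  transpose-< {x} {k} {y} x< y< y≢x with y ℕ.≟ x | y ℕ.≟ k
  ... | yes y≡x | _        = ⊥-elim (y≢x y≡x)
  ... | no  _   | yes refl = ≤∧≢⇒< (s≤s⁻¹ x<) (λ x≡y → y≢x (sym x≡y))
  ... | no  _   | no  y≢k  = ≤∧≢⇒< (s≤s⁻¹ y<) y≢k

  InjectiveBelow : ℕ → List ℕ → Set
  InjectiveBelow k l = Unique l × All (_< k) l

  -- Every injective list below suc k is x ∷ t with x < suc k and t injective below suc k avoiding x;
  -- transposing x and k turns t into an injective list below k.
  injectiveLists : ℕ → List (List ℕ)
  injectiveLists zero    = [] ∷ []
  injectiveLists (suc k) = [] ∷ cartesianProductWith (λ x t → x ∷ map (transpose x k) t) (upTo (suc k)) (injectiveLists k)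

  arrangements : ℕ → ℕ
  arrangements zero    = 1
  arrangements (suc k) = suc (suc k * arrangements k)

  length-injectiveLists : ∀ k → length (injectiveLists k) ≡ arrangements k
  length-injectiveLists zero    = refl
  length-injectiveLists (suc k) =
    cong suc (trans (length-cartesianProductWith _ (upTo (suc k)) (injectiveLists k))
                    (cong₂ _*_ (length-upTo (suc k)) (length-injectiveLists k)))

  injectiveLists-complete : ∀ k l → InjectiveBelow k l → l ∈ injectiveLists k
  injectiveLists-complete zero    []      _             = here refl
  injectiveLists-complete zero    (_ ∷ _) (_ , () ∷ _)
  injectiveLists-complete (suc k) []      _             = here refl
  injectiveLists-complete (suc k) (x ∷ t) (x∉t ∷ t-unique , x< ∷ t<) =
    there (subst (λ t′ → x ∷ t′ ∈ _) (map-transpose-involutive t)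
            (∈-cartesianProductWith⁺ _ (∈-upTo⁺ x<) (injectiveLists-complete k (map (transpose x k) t) (t′-unique , t′<))))
    where
      map-transpose-involutive : ∀ t → map (transpose x k) (map (transpose x k) t) ≡ t
      map-transpose-involutive t = trans (sym (map-∘ t)) (trans (map-cong (transpose-involutive x k) t) (map-id t))

      t′-unique : Unique (map (transpose x k) t)
      t′-unique = Unique.map⁺ (transpose-injective x k) t-unique

      t′< : All (_< k) (map (transpose x k) t)
      t′< = All-map⁺ (All.zipWith (λ (x≢y , y<) → transpose-< x< y< (λ y≡x → x≢y (sym y≡x))) (x∉t , t<))

  ValidCode : ℕ → List (List ℕ) → Set
  ValidCode k []      = ⊤
  ValidCode k (l ∷ c) = InjectiveBelow k l × ValidCode (suc k) c

  codes : ℕ → ℕ → List (List (List ℕ))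
  codes k zero      = [] ∷ []
  codes k (suc len) = cartesianProductWith _∷_ (injectiveLists k) (codes (suc k) len)

  codeCount : ℕ → ℕ → ℕ
  codeCount k zero      = 1
  codeCount k (suc len) = arrangements k * codeCount (suc k) len

  length-codes : ∀ k len → length (codes k len) ≡ codeCount k len
  length-codes k zero      = refl
  length-codes k (suc len) = trans (length-cartesianProductWith _∷_ (injectiveLists k) (codes (suc k) len))
                                   (cong₂ _*_ (length-injectiveLists k) (length-codes (suc k) len))

  codes-complete : ∀ k c → ValidCode k c → c ∈ codes k (length c)
  codes-complete k []      _               = here refl
  codes-complete k (l ∷ c) (l-valid , c-valid) =
    ∈-cartesianProductWith⁺ _∷_ (injectiveLists-complete k l l-valid) (codes-complete (suc k) c c-valid)

  module FinPosition {n : ℕ} = Position (Fin._≟_ {n})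
  open FinPosition
  open SourcesLastOrder

  code : ∀ {n} (G : DOAG n) → SourcesLastOrder G → List (List ℕ)
  code G O = map (λ v → map (position (order O)) (out G v)) (order O)

  length-order : ∀ {n} {G : DOAG n} (O : SourcesLastOrder G) → length (order O) ≡ n
  length-order {n} O = ≤-antisym (unique⇒length-≤ (unique O))
    (subst (_≤ length (order O)) (length-tabulate (λ i → i)) (unique-⊆⇒length-≤ (Unique.allFin⁺ n) (λ {v} _ → complete O v)))

  code-valid : ∀ {n} (G : DOAG n) (O : SourcesLastOrder G) → ValidCode 0 (code G O)
  code-valid {n} G O = valid-from [] (order O) refl
    where
      entry : Fin n → List ℕ
      entry v = map (position (order O)) (out G v)

      valid-from : ∀ pre suf → order O ≡ pre ++ suf → ValidCode (length pre) (map entry suf)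
      valid-from pre []        _  = tt
      valid-from pre (v ∷ suf) eq =
        ( Unique.map⁺ (position-injective (complete O _) (complete O _)) (outUnique G v)
        , All-map⁺ (All.map position<pre (childrenFirst O pre v suf eq)) )
        , subst (λ k → ValidCode k (map entry suf)) (length-snoc pre v)
                (valid-from (pre ++ v ∷ []) suf (trans eq (sym (++-assoc pre (v ∷ []) suf))))
        where
          position<pre : ∀ {w} → w ∈ pre → position (order O) w < length pre
          position<pre {w} w∈ =
            subst (_< length pre) (sym (trans (cong (λ o → position o w) eq) (position-++ˡ w∈))) (position<length w∈)

  sources-filter : ∀ {n} {G : DOAG n} (O : SourcesLastOrder G) →
                   filter (_∈? sources G) (order O) ≡ sources G
  sources-filter {G = G} O = trans (filter-++ (_∈? sources G) (inner O) (sources G))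
    (cong₂ _++_ (filter-none (_∈? sources G) (inner-nonSources O)) (filter-all (_∈? sources G) (All.tabulate (λ v∈ → v∈))))

  -- The codes carry no source markers: the sources are
  -- the vertices without parents, and their order ≺_∅ is recovered because they come last, in that order.
  module SameCode {m : ℕ} {G H : DOAG (suc m)} (OG : SourcesLastOrder G) (OH : SourcesLastOrder H)
                  (same-code : code G OG ≡ code H OH) where

    private
      d : Fin (suc m)
      d = Fin.zero

      oG oH : List (Fin (suc m))
      oG = order OG
      oH = order OH

      length-oG≡oH : length oG ≡ length oH
      length-oG≡oH = trans (length-order OG) (sym (length-order OH))

      <oG⇒<oH : ∀ {k} → k < length oG → k < length oH
      <oG⇒<oH = subst (_ <_) length-oG≡oH

      <oH⇒<oG : ∀ {k} → k < length oH → k < length oG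
      <oH⇒<oG = subst (_ <_) (sym length-oG≡oH)

    relabel : Fin (suc m) → Fin (suc m)
    relabel v = nth d oH (position oG v)

    relabel⁻¹ : Fin (suc m) → Fin (suc m)
    relabel⁻¹ w = nth d oG (position oH w)

    same-entry : ∀ k → k < length oG → map (position oG) (out G (nth d oG k)) ≡ map (position oH) (out H (nth d oH k))
    same-entry k k< = begin
      map (position oG) (out G (nth d oG k)) ≡⟨ nth-map (λ v → map (position oG) (out G v)) d [] oG k k< ⟨
      nth [] (code G OG) k                   ≡⟨ cong (λ c → nth [] c k) same-code ⟩
      nth [] (code H OH) k                   ≡⟨ nth-map (λ v → map (position oH) (out H v)) d [] oH k (<oG⇒<oH k<) ⟩
      map (position oH) (out H (nth d oH k)) ∎
      where open ≡-Reasoning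

    relabel-out : ∀ v → map relabel (out G v) ≡ out H (relabel v)
    relabel-out v = begin
        map relabel (out G v)
      ≡⟨ map-∘ (out G v) ⟩
        map (nth d oH) (map (position oG) (out G v))
      ≡⟨ cong (λ u → map (nth d oH) (map (position oG) (out G u))) (nth-position d (complete OG v)) ⟨
        map (nth d oH) (map (position oG) (out G (nth d oG (position oG v))))
      ≡⟨ cong (map (nth d oH)) (same-entry _ (position<length (complete OG v))) ⟩
        map (nth d oH) (map (position oH) (out H (relabel v)))
      ≡⟨ map-∘ (out H (relabel v)) ⟨
        map (nth d oH ∘ position oH) (out H (relabel v))
      ≡⟨ map-id-local (All.tabulate (λ {w} _ → nth-position d (complete OH w))) ⟩
        out H (relabel v)
      ∎
      where open ≡-Reasoning

    position-relabel : ∀ v → position oH (relabel v) ≡ position oG v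
    position-relabel v = position-nth d (unique OH) _ (<oG⇒<oH (position<length (complete OG v)))

    relabel-injective : ∀ {u w} → relabel u ≡ relabel w → u ≡ w
    relabel-injective {u} {w} eq = position-injective (complete OG u) (complete OG w)
      (trans (sym (position-relabel u)) (trans (cong (position oH) eq) (position-relabel w)))

    relabel-relabel⁻¹ : ∀ w → relabel (relabel⁻¹ w) ≡ w
    relabel-relabel⁻¹ w = trans (cong (nth d oH) (position-nth d (unique OG) _ (<oH⇒<oG (position<length (complete OH w)))))
                                (nth-position d (complete OH w))

    relabel-order : map relabel oG ≡ oH
    relabel-order = nth-extensionality d (map relabel oG) oH (trans (length-map relabel oG) length-oG≡oH) λ k k< →
      let k<oG = subst (k <_) (length-map relabel oG) k< in
      trans (nth-map relabel d d oG k k<oG) (cong (nth d oH) (position-nth d (unique OG) k k<oG))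

    out-relabel⁻¹ : ∀ u → out H u ≡ map relabel (out G (relabel⁻¹ u))
    out-relabel⁻¹ u = trans (cong (out H) (sym (relabel-relabel⁻¹ u))) (sym (relabel-out (relabel⁻¹ u)))

    relabel-source : ∀ v → v ∈ sources G → relabel v ∈ sources H
    relabel-source v v∈sources = Equivalence.from (srcSpec H (relabel v)) λ u v′∈out →
      let x , x∈out , v′≡x′ = ∈-map⁻ relabel (subst (relabel v ∈_) (out-relabel⁻¹ u) v′∈out)
      in child∉sources G (subst (_∈ out G (relabel⁻¹ u)) (sym (relabel-injective v′≡x′)) x∈out) v∈sources

    relabel-source⁻¹ : ∀ v → relabel v ∈ sources H → v ∈ sources G
    relabel-source⁻¹ v v′∈sources = Equivalence.from (srcSpec G v) λ u v∈out →
      child∉sources H (subst (relabel v ∈_) (relabel-out u) (∈-map⁺ relabel v∈out)) v′∈sources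

    relabel-sources : map relabel (sources G) ≡ sources H
    relabel-sources = begin
      map relabel (sources G)                 ≡⟨ cong (map relabel) (sources-filter OG) ⟨
      map relabel (filter (_∈? sources G) oG) ≡⟨ map-filter _ _ relabel relabel-source relabel-source⁻¹ oG ⟩
      filter (_∈? sources H) (map relabel oG) ≡⟨ cong (filter (_∈? sources H)) relabel-order ⟩
      filter (_∈? sources H) oH               ≡⟨ sources-filter OH ⟩
      sources H                               ∎
      where open ≡-Reasoning

    ≅-from-code : G ≅ H
    ≅-from-code = mk⤖ (relabel-injective , λ w → relabel⁻¹ w , λ { refl → relabel-relabel⁻¹ w })
                , relabel-out
                , relabel-sources

  canonicalCode : ∀ {n} → DOAG n → List (List ℕ)
  canonicalCode G = code G (sourcesLastOrder G)

  canonicalCode∈codes : ∀ {n} (G : DOAG n) → canonicalCode G ∈ codes 0 n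
  canonicalCode∈codes G = subst (λ len → canonicalCode G ∈ codes 0 len)
    (trans (length-map _ (order (sourcesLastOrder G))) (length-order (sourcesLastOrder G)))
    (codes-complete 0 (canonicalCode G) (code-valid G (sourcesLastOrder G)))

  length-≤-codeCount : ∀ m (Gs : List (DOAG (suc m))) → AllPairs (λ G H → ¬ (G ≅ H)) Gs → length Gs ≤ codeCount 0 (suc m)
  length-≤-codeCount m Gs pairwise-≇ = begin
    length Gs                       ≡⟨ length-map canonicalCode Gs ⟨
    length (map canonicalCode Gs)   ≤⟨ unique-⊆⇒length-≤ codes-unique codes-⊆ ⟩
    length (codes 0 (suc m))        ≡⟨ length-codes 0 (suc m) ⟩
    codeCount 0 (suc m)             ∎
    where
      open ≤-Reasoning

      codes-unique : Unique (map canonicalCode Gs)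
      codes-unique = AllPairs.map⁺ (AllPairs.map (λ {G} {H} G≇H same-code →
        G≇H (SameCode.≅-from-code (sourcesLastOrder G) (sourcesLastOrder H) same-code)) pairwise-≇)

      codes-⊆ : map canonicalCode Gs ⊆ codes 0 (suc m)
      codes-⊆ c∈ with ∈-map⁻ canonicalCode c∈
      ... | G , _ , refl = canonicalCode∈codes G

module BinomialTheorem where

  open import Data.Nat using (ℕ; zero; suc; _+_; _*_; _^_; _!; _∸_; _≤_)
  import Data.Nat.Properties as ℕP
  open import Data.Nat.Properties using (+-suc; n<1+n; _!*_!≢0)
  open import Data.Nat.Combinatorics using (_C_; nCk+nC[k+1]≡[n+1]C[k+1]; k>n⇒nCk≡0; nCk≡n!/k![n-k]!; k![n∸k]!∣n!)
  open import Data.Nat.DivMod using (m/n*n≡m)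
  open import Data.Nat.Tactic.RingSolver using (solve-∀)
  open import Relation.Binary.PropositionalEquality using (_≡_; refl; sym; trans; cong; module ≡-Reasoning)

  module ℕ∑ = PartialSums ℕP.+-*-commutativeSemiring

  binomial : ∀ x k → ℕ∑.∑≤ (λ i → (k C i) * x ^ i) k ≡ suc x ^ k
  binomial x zero    = refl
  binomial x (suc k) = begin
      1 + ∑≤ (λ i → (suc k C suc i) * x ^ suc i) k
    ≡⟨ cong (1 +_) (∑≤-cong k (λ i _ → pascal i)) ⟩
      1 + ∑≤ (λ i → x * ((k C i) * x ^ i) + (k C suc i) * x ^ suc i) k
    ≡⟨ cong (1 +_) (∑≤-+ (λ i → x * ((k C i) * x ^ i)) _ k) ⟩
      1 + (∑≤ (λ i → x * ((k C i) * x ^ i)) k + T)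
    ≡⟨ cong (λ s → 1 + (s + T)) (∑≤-*ˡ x _ k) ⟩
      1 + (x * B + T)
    ≡⟨ +-suc (x * B) T ⟨
      x * B + ∑≤ (λ i → (k C i) * x ^ i) (suc k)
    ≡⟨ cong (x * B +_) (∑≤-suc _ k) ⟩
      x * B + (B + (k C suc k) * x ^ suc k)
    ≡⟨ cong (λ c → x * B + (B + c * x ^ suc k)) (k>n⇒nCk≡0 (n<1+n k)) ⟩
      x * B + (B + 0)
    ≡⟨ cong (x * B +_) (ℕP.+-identityʳ B) ⟩
      x * B + B
    ≡⟨ ℕP.+-comm (x * B) B ⟩
      suc x * B
    ≡⟨ cong (suc x *_) (binomial x k) ⟩
      suc x ^ suc k
    ∎
    where
      open ℕ∑
      open ≡-Reasoning
      B T : ℕ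
      B = ∑≤ (λ i → (k C i) * x ^ i) k
      T = ∑≤ (λ i → (k C suc i) * x ^ suc i) k

      pascal : ∀ i → (suc k C suc i) * x ^ suc i ≡ x * ((k C i) * x ^ i) + (k C suc i) * x ^ suc i
      pascal i = trans (cong (_* x ^ suc i) (sym (nCk+nC[k+1]≡[n+1]C[k+1] k i)))
                       (distribute (k C i) (k C suc i) x (x ^ i))
        where
          distribute : ∀ a b x y → (a + b) * (x * y) ≡ x * (a * y) + b * (x * y)
          distribute = solve-∀

  C*!*!≡! : ∀ {n k} → k ≤ n → (n C k) * (k ! * (n ∸ k) !) ≡ n !
  C*!*!≡! {n} {k} k≤n =
    trans (cong (_* (k ! * (n ∸ k) !)) (nCk≡n!/k![n-k]! k≤n)) (m/n*n≡m {{k !* (n ∸ k) !≢0}} (k![n∸k]!∣n! k≤n))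

module ExponentialSeries where

  open import Algebra.Bundles using (CommutativeRing)
  open import Data.Integer as ℤ using (+_)
  import Data.Integer.Properties as ℤP
  open import Data.Nat as ℕ using (ℕ; zero; suc; _^_; _!; _∸_; NonZero)
  import Data.Nat.Properties as ℕP
  open import Data.Nat.Properties using (_!≢0; ^-zeroˡ)
  open import Data.Nat.Combinatorics using (_C_)
  open import Data.Nat.Tactic.RingSolver using (solve-∀)
  open import Data.Product using (∃-syntax; _,_)
  open import Data.Rational using (ℚ; 0ℚ; _/_; _+_; _*_; _≤_; toℚᵘ; nonNegative)
  import Data.Rational.Properties as ℚP
  import Data.Rational.Unnormalised as ℚᵘ
  import Data.Rational.Unnormalised.Properties as ℚᵘP
  open import Function using (_∘_)
  open import Relation.Binary.PropositionalEquality
    using (_≡_; refl; sym; trans; cong; cong₂; subst; subst₂; module ≡-Reasoning)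
  open import Defs using (sf; expPartial)
  open Counting using (arrangements; codeCount)
  open BinomialTheorem using (module ℕ∑; binomial; C*!*!≡!)

  ℚ-commutativeSemiring : CommutativeSemiring 0ℓ 0ℓ
  ℚ-commutativeSemiring = CommutativeRing.commutativeSemiring ℚP.+-*-commutativeRing

  open PartialSums ℚ-commutativeSemiring
  open import Algebra.Properties.CommutativeSemigroup (CommutativeSemiring.*-commutativeSemigroup ℚ-commutativeSemiring)
    using () renaming (interchange to *-interchange)

  toℚᵘ-/ : ∀ a b .{{_ : NonZero b}} → toℚᵘ ((+ a) / b) ℚᵘ.≃ (+ a) ℚᵘ./ b
  toℚᵘ-/ a (suc b) = ℚP.toℚᵘ-fromℚᵘ (ℚᵘ.mkℚᵘ (+ a) b)

  /-≤ : ∀ a b c d .{{_ : NonZero b}} .{{_ : NonZero d}} → a ℕ.* d ℕ.≤ c ℕ.* b → (+ a) / b ≤ (+ c) / d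
  /-≤ a b@(suc _) c d@(suc _) ad≤cb =
    ℚP.toℚᵘ-cancel-≤ (ℚᵘP.≤-respˡ-≃ (ℚᵘP.≃-sym (toℚᵘ-/ a b)) (ℚᵘP.≤-respʳ-≃ (ℚᵘP.≃-sym (toℚᵘ-/ c d))
      (ℚᵘ.*≤* (subst₂ ℤ._≤_ (ℤP.pos-* a d) (ℤP.pos-* c b) (ℤ.+≤+ ad≤cb)))))

  /+/ : ∀ a b c d e f .{{_ : NonZero b}} .{{_ : NonZero d}} .{{_ : NonZero f}} →
        (a ℕ.* d ℕ.+ c ℕ.* b) ℕ.* f ≡ e ℕ.* (b ℕ.* d) → (+ a) / b + (+ c) / d ≡ (+ e) / f
  /+/ a b@(suc _) c d@(suc _) e f@(suc _) eq = ℚP.toℚᵘ-injective (ℚᵘP.≃-trans (ℚP.toℚᵘ-homo-+ ((+ a) / b) ((+ c) / d))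
    (ℚᵘP.≃-trans (ℚᵘP.+-cong (toℚᵘ-/ a b) (toℚᵘ-/ c d)) (ℚᵘP.≃-trans (ℚᵘ.*≡* cross) (ℚᵘP.≃-sym (toℚᵘ-/ e f)))))
    where
      cross : (+ a ℤ.* + d ℤ.+ + c ℤ.* + b) ℤ.* + f ≡ + e ℤ.* + (b ℕ.* d)
      cross = trans (cong (ℤ._* + f) (trans (cong₂ ℤ._+_ (sym (ℤP.pos-* a d)) (sym (ℤP.pos-* c b)))
                                            (sym (ℤP.pos-+ (a ℕ.* d) (c ℕ.* b)))))
                    (trans (sym (ℤP.pos-* (a ℕ.* d ℕ.+ c ℕ.* b) f)) (trans (cong +_ eq) (ℤP.pos-* e (b ℕ.* d))))

  /*/ : ∀ a b c d e f .{{_ : NonZero b}} .{{_ : NonZero d}} .{{_ : NonZero f}} →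
        (a ℕ.* c) ℕ.* f ≡ e ℕ.* (b ℕ.* d) → ((+ a) / b) * ((+ c) / d) ≡ (+ e) / f
  /*/ a b@(suc _) c d@(suc _) e f@(suc _) eq = ℚP.toℚᵘ-injective (ℚᵘP.≃-trans (ℚP.toℚᵘ-homo-* ((+ a) / b) ((+ c) / d))
    (ℚᵘP.≃-trans (ℚᵘP.*-cong (toℚᵘ-/ a b) (toℚᵘ-/ c d)) (ℚᵘP.≃-trans (ℚᵘ.*≡* cross) (ℚᵘP.≃-sym (toℚᵘ-/ e f)))))
    where
      cross : (+ a ℤ.* + c) ℤ.* + f ≡ + e ℤ.* + (b ℕ.* d)
      cross = trans (cong (ℤ._* + f) (sym (ℤP.pos-* a c)))
                    (trans (sym (ℤP.pos-* (a ℕ.* c) f)) (trans (cong +_ eq) (ℤP.pos-* e (b ℕ.* d))))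

  toℚ : ℕ → ℚ
  toℚ n = (+ n) / 1

  toℚ-mono-≤ : ∀ {m n} → m ℕ.≤ n → toℚ m ≤ toℚ n
  toℚ-mono-≤ {m} {n} m≤n = /-≤ m 1 n 1 (ℕP.*-monoˡ-≤ 1 m≤n)

  toℚ-* : ∀ m n → toℚ (m ℕ.* n) ≡ toℚ m * toℚ n
  toℚ-* m n = sym (/*/ m 1 n 1 (m ℕ.* n) 1 refl)

  /-nonNeg : ∀ a b .{{_ : NonZero b}} → 0ℚ ≤ (+ a) / b
  /-nonNeg a b = /-≤ 0 1 a b ℕ.z≤n

  toℚ-nonNeg : ∀ n → 0ℚ ≤ toℚ n
  toℚ-nonNeg n = /-nonNeg n 1

  *-nonNeg : ∀ {p q} → 0ℚ ≤ p → 0ℚ ≤ q → 0ℚ ≤ p * q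
  *-nonNeg {p} {q} 0≤p 0≤q = ℚP.nonNegative⁻¹ (p * q) {{ℚP.nonNeg*nonNeg⇒nonNeg p {{nonNegative 0≤p}} q {{nonNegative 0≤q}}}}

  *-monoˡ-≤-0≤ : ∀ {r p q} → 0ℚ ≤ r → p ≤ q → r * p ≤ r * q
  *-monoˡ-≤-0≤ {r} 0≤r = ℚP.*-monoˡ-≤-nonNeg r {{nonNegative 0≤r}}

  *-monoʳ-≤-0≤ : ∀ {r p q} → 0ℚ ≤ r → p ≤ q → p * r ≤ q * r
  *-monoʳ-≤-0≤ {r} 0≤r = ℚP.*-monoʳ-≤-nonNeg r {{nonNegative 0≤r}}

  p≤p+q : ∀ {p q} → 0ℚ ≤ q → p ≤ p + q
  p≤p+q {p} 0≤q = subst (_≤ p + _) (ℚP.+-identityʳ p) (ℚP.+-monoʳ-≤ p 0≤q)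

  ∑≤-mono-≤ : ∀ {f g} → (∀ i → f i ≤ g i) → ∀ k → ∑≤ f k ≤ ∑≤ g k
  ∑≤-mono-≤ f≤g zero    = f≤g 0
  ∑≤-mono-≤ f≤g (suc k) = ℚP.+-mono-≤ (f≤g 0) (∑≤-mono-≤ (f≤g ∘ suc) k)

  ∑≤-nonNeg : ∀ {f} → (∀ i → 0ℚ ≤ f i) → ∀ k → 0ℚ ≤ ∑≤ f k
  ∑≤-nonNeg 0≤f zero    = 0≤f 0
  ∑≤-nonNeg 0≤f (suc k) = ℚP.+-mono-≤ (0≤f 0) (∑≤-nonNeg (0≤f ∘ suc) k)

  ∑≤-extend-≤ : ∀ {f} → (∀ i → 0ℚ ≤ f i) → ∀ e k → ∑≤ f k ≤ ∑≤ f (e ℕ.+ k)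
  ∑≤-extend-≤ 0≤f zero    k = ℚP.≤-refl
  ∑≤-extend-≤ {f} 0≤f (suc e) k =
    ℚP.≤-trans (∑≤-extend-≤ 0≤f e k) (subst (∑≤ f (e ℕ.+ k) ≤_) (sym (∑≤-suc f (e ℕ.+ k))) (p≤p+q (0≤f _)))

  cauchyProduct : (ℕ → ℚ) → (ℕ → ℚ) → ℕ → ℚ
  cauchyProduct u v k = ∑≤ (λ i → u i * v (k ∸ i)) k

  ∑≤-cauchyProduct-suc : ∀ u v N →
                         ∑≤ (cauchyProduct u v) (suc N) ≡ ∑≤ (λ k → u 0 * v k) (suc N) + ∑≤ (cauchyProduct (u ∘ suc) v) N
  ∑≤-cauchyProduct-suc u v N =
    trans (cong (λ s → u 0 * v 0 + s) (∑≤-+ (λ k → u 0 * v (suc k)) (cauchyProduct (u ∘ suc) v) N))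
          (sym (ℚP.+-assoc (u 0 * v 0) _ _))

  -- Every term u i * v j with i ≤ a and j ≤ b occurs in the first a + b terms of the Cauchy product,
  -- whose remaining summands are nonnegative.
  ∑≤-*-∑≤-≤-cauchyProduct : ∀ {u v} → (∀ i → 0ℚ ≤ u i) → (∀ i → 0ℚ ≤ v i) → ∀ a b →
                            ∑≤ u a * ∑≤ v b ≤ ∑≤ (cauchyProduct u v) (a ℕ.+ b)
  ∑≤-*-∑≤-≤-cauchyProduct {u} {v} 0≤u 0≤v zero b = begin
    u 0 * ∑≤ v b                ≡⟨ ∑≤-*ˡ (u 0) v b ⟨
    ∑≤ (λ k → u 0 * v k) b      ≤⟨ ∑≤-mono-≤ first≤ b ⟩
    ∑≤ (cauchyProduct u v) b    ∎
    where
      open ℚP.≤-Reasoning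
      first≤ : ∀ k → u 0 * v k ≤ cauchyProduct u v k
      first≤ zero    = ℚP.≤-refl
      first≤ (suc k) = p≤p+q (∑≤-nonNeg (λ i → *-nonNeg (0≤u (suc i)) (0≤v (k ∸ i))) k)
  ∑≤-*-∑≤-≤-cauchyProduct {u} {v} 0≤u 0≤v (suc a) b = begin
      (u 0 + ∑≤ (u ∘ suc) a) * ∑≤ v b
    ≡⟨ ℚP.*-distribʳ-+ (∑≤ v b) (u 0) _ ⟩
      u 0 * ∑≤ v b + ∑≤ (u ∘ suc) a * ∑≤ v b
    ≡⟨ cong (_+ ∑≤ (u ∘ suc) a * ∑≤ v b) (∑≤-*ˡ (u 0) v b) ⟨
      ∑≤ (λ k → u 0 * v k) b + ∑≤ (u ∘ suc) a * ∑≤ v b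
    ≤⟨ ℚP.+-mono-≤ (∑≤-extend-≤ (λ k → *-nonNeg (0≤u 0) (0≤v k)) (suc a) b)
                   (∑≤-*-∑≤-≤-cauchyProduct (0≤u ∘ suc) 0≤v a b) ⟩
      ∑≤ (λ k → u 0 * v k) (suc a ℕ.+ b) + ∑≤ (cauchyProduct (u ∘ suc) v) (a ℕ.+ b)
    ≡⟨ ∑≤-cauchyProduct-suc u v (a ℕ.+ b) ⟨
      ∑≤ (cauchyProduct u v) (suc a ℕ.+ b)
    ∎
    where open ℚP.≤-Reasoning

  expTerm : ℕ → ℕ → ℚ
  expTerm x i = ((+ (x ^ i)) / (i !)) {{i !≢0}}

  expTerm-nonNeg : ∀ x i → 0ℚ ≤ expTerm x i
  expTerm-nonNeg x i = /-nonNeg (x ^ i) (i !) {{i !≢0}}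

  expPartial≡∑≤ : ∀ x K → expPartial x K ≡ ∑≤ (expTerm x) K
  expPartial≡∑≤ x zero    = refl
  expPartial≡∑≤ x (suc K) = trans (cong (_+ expTerm x (suc K)) (expPartial≡∑≤ x K)) (sym (∑≤-suc (expTerm x) K))

  ∑≤-/ : ∀ g D .{{_ : NonZero D}} k → ∑≤ (λ i → (+ g i) / D) k ≡ (+ ℕ∑.∑≤ g k) / D
  ∑≤-/ g D zero    = refl
  ∑≤-/ g D (suc k) = trans (cong (λ s → (+ g 0) / D + s) (∑≤-/ (g ∘ suc) D k))
    (/+/ (g 0) D (ℕ∑.∑≤ (g ∘ suc) k) D (g 0 ℕ.+ ℕ∑.∑≤ (g ∘ suc) k) D (common-denominator (g 0) _ D))
    where
      common-denominator : ∀ a c D → (a ℕ.* D ℕ.+ c ℕ.* D) ℕ.* D ≡ (a ℕ.+ c) ℕ.* (D ℕ.* D)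
      common-denominator = solve-∀

  expTerm-cauchyProduct : ∀ x k → cauchyProduct (expTerm x) (expTerm 1) k ≡ expTerm (suc x) k
  expTerm-cauchyProduct x k = begin
    cauchyProduct (expTerm x) (expTerm 1) k          ≡⟨ ∑≤-cong k term ⟩
    ∑≤ (λ i → (+ ((k C i) ℕ.* x ^ i)) / (k !)) k     ≡⟨ ∑≤-/ (λ i → (k C i) ℕ.* x ^ i) (k !) k ⟩
    (+ ℕ∑.∑≤ (λ i → (k C i) ℕ.* x ^ i) k) / (k !)    ≡⟨ cong (λ n → (+ n) / (k !)) (binomial x k) ⟩
    expTerm (suc x) k                                ∎
    where
      open ≡-Reasoning
      instance _ = k !≢0

      term : ∀ i → i ℕ.≤ k → expTerm x i * expTerm 1 (k ∸ i) ≡ (+ ((k C i) ℕ.* x ^ i)) / (k !)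
      term i i≤k = /*/ (x ^ i) (i !) (1 ^ (k ∸ i)) ((k ∸ i) !) ((k C i) ℕ.* x ^ i) (k !) {{i !≢0}} {{(k ∸ i) !≢0}}
        (trans (cong₂ (λ p q → (x ^ i ℕ.* p) ℕ.* q) (^-zeroˡ (k ∸ i)) (sym (C*!*!≡! i≤k))) (rearrange (x ^ i) (k C i) _))
        where
          rearrange : ∀ X C F → (X ℕ.* 1) ℕ.* (C ℕ.* F) ≡ (C ℕ.* X) ℕ.* F
          rearrange = solve-∀

  expPartial-*-expPartial-≤ : ∀ x a b → expPartial x a * expPartial 1 b ≤ expPartial (suc x) (a ℕ.+ b)
  expPartial-*-expPartial-≤ x a b = begin
      expPartial x a * expPartial 1 b
    ≡⟨ cong₂ _*_ (expPartial≡∑≤ x a) (expPartial≡∑≤ 1 b) ⟩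
      ∑≤ (expTerm x) a * ∑≤ (expTerm 1) b
    ≤⟨ ∑≤-*-∑≤-≤-cauchyProduct (expTerm-nonNeg x) (expTerm-nonNeg 1) a b ⟩
      ∑≤ (cauchyProduct (expTerm x) (expTerm 1)) (a ℕ.+ b)
    ≡⟨ ∑≤-cong (a ℕ.+ b) (λ k _ → expTerm-cauchyProduct x k) ⟩
      ∑≤ (expTerm (suc x)) (a ℕ.+ b)
    ≡⟨ expPartial≡∑≤ (suc x) (a ℕ.+ b) ⟨
      expPartial (suc x) (a ℕ.+ b)
    ∎
    where open ℚP.≤-Reasoning

  expPartial-at-1 : ∀ k → expPartial 1 k ≡ ((+ arrangements k) / (k !)) {{k !≢0}}
  expPartial-at-1 zero    = refl
  expPartial-at-1 (suc k) = trans (cong (_+ expTerm 1 (suc k)) (expPartial-at-1 k))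
    (/+/ (arrangements k) (k !) (1 ^ suc k) (suc k !) (arrangements (suc k)) (suc k !) {{k !≢0}} {{suc k !≢0}} {{suc k !≢0}}
         (trans (cong (λ p → (arrangements k ℕ.* suc k ! ℕ.+ p ℕ.* k !) ℕ.* suc k !) (^-zeroˡ (suc k)))
                (common-denominator (arrangements k) k (k !))))
    where
      common-denominator : ∀ A k F → (A ℕ.* (suc k ℕ.* F) ℕ.+ 1 ℕ.* F) ℕ.* (suc k ℕ.* F)
                                     ≡ suc (suc k ℕ.* A) ℕ.* (F ℕ.* (suc k ℕ.* F))
      common-denominator = solve-∀

  toℚ-arrangements : ∀ k → toℚ (arrangements k) ≡ toℚ (k !) * expPartial 1 k
  toℚ-arrangements k = sym (trans (cong (toℚ (k !) *_) (expPartial-at-1 k))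
    (/*/ (k !) 1 (arrangements k) (k !) (arrangements k) 1 {{_}} {{k !≢0}} (rearrange (k !) (arrangements k))))
    where
      rearrange : ∀ F A → (F ℕ.* A) ℕ.* 1 ≡ A ℕ.* (1 ℕ.* F)
      rearrange = solve-∀

  codeCount-suc : ∀ k n → codeCount k (suc n) ≡ codeCount k n ℕ.* arrangements (k ℕ.+ n)
  codeCount-suc k zero    = trans (ℕP.*-identityʳ (arrangements k))
    (trans (cong arrangements (sym (ℕP.+-identityʳ k))) (sym (ℕP.*-identityˡ (arrangements (k ℕ.+ 0)))))
  codeCount-suc k (suc n) = begin
      arrangements k ℕ.* codeCount (suc k) (suc n)
    ≡⟨ cong (arrangements k ℕ.*_) (codeCount-suc (suc k) n) ⟩
      arrangements k ℕ.* (codeCount (suc k) n ℕ.* arrangements (suc k ℕ.+ n))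
    ≡⟨ ℕP.*-assoc (arrangements k) _ _ ⟨
      codeCount k (suc n) ℕ.* arrangements (suc k ℕ.+ n)
    ≡⟨ cong (λ i → codeCount k (suc n) ℕ.* arrangements i) (ℕP.+-suc k n) ⟨
      codeCount k (suc n) ℕ.* arrangements (k ℕ.+ suc n)
    ∎
    where open ≡-Reasoning

  codeCount≤sf*expPartial : ∀ m → ∃[ K ] toℚ (codeCount 0 (suc m)) ≤ toℚ (sf m) * expPartial m K
  codeCount≤sf*expPartial zero    = 0 , ℚP.≤-refl
  codeCount≤sf*expPartial (suc m) with K , bound ← codeCount≤sf*expPartial m = K ℕ.+ suc m , (begin
      toℚ (codeCount 0 (suc (suc m)))
    ≡⟨ cong toℚ (codeCount-suc 0 (suc m)) ⟩
      toℚ (codeCount 0 (suc m) ℕ.* arrangements (suc m))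
    ≡⟨ toℚ-* (codeCount 0 (suc m)) _ ⟩
      toℚ (codeCount 0 (suc m)) * toℚ (arrangements (suc m))
    ≤⟨ *-monoʳ-≤-0≤ (toℚ-nonNeg (arrangements (suc m))) bound ⟩
      (toℚ (sf m) * expPartial m K) * toℚ (arrangements (suc m))
    ≡⟨ cong (toℚ (sf m) * expPartial m K *_) (toℚ-arrangements (suc m)) ⟩
      (toℚ (sf m) * expPartial m K) * (toℚ (suc m !) * expPartial 1 (suc m))
    ≡⟨ *-interchange (toℚ (sf m)) _ _ _ ⟩
      (toℚ (sf m) * toℚ (suc m !)) * (expPartial m K * expPartial 1 (suc m))
    ≤⟨ *-monoˡ-≤-0≤ (*-nonNeg (toℚ-nonNeg (sf m)) (toℚ-nonNeg (suc m !))) (expPartial-*-expPartial-≤ m K (suc m)) ⟩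
      (toℚ (sf m) * toℚ (suc m !)) * expPartial (suc m) (K ℕ.+ suc m)
    ≡⟨ cong (_* expPartial (suc m) (K ℕ.+ suc m)) (toℚ-* (sf m) (suc m !)) ⟨
      toℚ (sf (suc m)) * expPartial (suc m) (K ℕ.+ suc m)
    ∎)
    where open ℚP.≤-Reasoning

open import Defs
open import Data.Nat using (ℕ; suc)
open import Data.List using (List; length)
open import Data.List.Relation.Unary.AllPairs using (AllPairs)
open import Data.Product using (∃-syntax; _,_)
open import Data.Integer using (+_)
open import Data.Rational using (ℚ; 0ℚ; _/_; _+_; _*_; _≤_; _<_)
import Data.Rational.Properties as ℚP
open import Relation.Nullary using (¬_)
open Counting using (codeCount; length-≤-codeCount)
open ExponentialSeries using (toℚ; toℚ-mono-≤; codeCount≤sf*expPartial; p≤p+q)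

lemma5p1 : (m : ℕ) (Gs : List (DOAG (suc m))) →
           AllPairs (λ G H → ¬ (G ≅ H)) Gs →
           (ε : ℚ) → 0ℚ < ε →
           ∃[ K ] ((+ length Gs) / 1 ≤ ((+ sf m) / 1) * expPartial m K + ε)
lemma5p1 m Gs pairwise-≇ ε 0<ε with K , bound ← codeCount≤sf*expPartial m = K , (begin
  toℚ (length Gs)                   ≤⟨ toℚ-mono-≤ (length-≤-codeCount m Gs pairwise-≇) ⟩
  toℚ (codeCount 0 (suc m))         ≤⟨ bound ⟩
  toℚ (sf m) * expPartial m K       ≤⟨ p≤p+q (ℚP.<⇒≤ 0<ε) ⟩
  toℚ (sf m) * expPartial m K + ε   ∎)
  where open ℚP.≤-Reasoning
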